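{- Fix an integer $r\ge1$. There is a constant $c>0$ depending only on $r$ such that for all sufficiently large $n$, every connected graph $G=(V,E)$ on $n$ nodes with minimum degree $\delta(G)\ge \frac{n}{2}+r$ has at least $c\,n^r$ distinct node sets of size $r$ that are dynamos in two-way $r$-bootstrap percolation (i.e., $G$ has $\Omega(n^r)$ dynamos of size $r$).
   Context: A configuration is a map $\mathcal{C}:V\to\{b,w\}$ (black/white). In two-way $r$-bootstrap percolation, starting from $\mathcal{C}_0$, in each round $t\ge1$ all nodes update simultaneously: $\mathcal{C}_t(v)=b$ if $v$ has at least $r$ neighbors that are black in $\mathcal{C}_{t-1}$, and $\mathcal{C}_t(v)=w$ otherwise. A set $D\subseteq V$ is a dynamo if for every initial configuration in which all nodes of $D$ are black, there is a round at which all nodes of $V$ are black. Standing assumption: $r$ is fixed while $n\to\infty$. -}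

module Defs where

open import Data.Nat using (ℕ; zero; suc; _≤_)
open import Data.Bool using (Bool; true; false; _∧_)
open import Data.Fin using (Fin)
open import Data.Fin.Subset using (Subset; ∣_∣; _∈_)
open import Data.Vec using (tabulate)
open import Data.Product using (∃)
open import Relation.Binary.PropositionalEquality using (_≡_)
open import Relation.Nullary.Decidable using (⌊_⌋)
open import Data.Nat using (_≤?_)

record Graph (n : ℕ) : Set where
  field
    adj     : Fin n → Fin n → Bool
    symm    : ∀ u v → adj u v ≡ adj v u
    irrefl  : ∀ v → adj v v ≡ false
open Graph public

nbhd : ∀ {n} → Graph n → Fin n → Subset n
nbhd G v = tabulate (adj G v)

degree : ∀ {n} → Graph n → Fin n → ℕ
degree G v = ∣ nbhd G v ∣

data Reach {n : ℕ} (G : Graph n) : Fin n → Fin n → Set where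
  here : ∀ {v} → Reach G v v
  step : ∀ {u w v} → adj G u w ≡ true → Reach G w v → Reach G u v

Connected : ∀ {n} → Graph n → Set
Connected G = ∀ u v → Reach G u v

-- configuration: true = black, false = white
Config : ℕ → Set
Config n = Fin n → Bool

blackNbrs : ∀ {n} → Graph n → Config n → Fin n → ℕ
blackNbrs G C v = ∣ tabulate (λ u → adj G v u ∧ C u) ∣

stepConfig : ∀ {n} → ℕ → Graph n → Config n → Config n
stepConfig r G C v = ⌊ r ≤? blackNbrs G C v ⌋

iterate : ∀ {n} → ℕ → Graph n → ℕ → Config n → Config n
iterate r G zero    C = C
iterate r G (suc t) C = stepConfig r G (iterate r G t C)

Dynamo : ∀ {n} → ℕ → Graph n → Subset n → Set
Dynamo {n} r G D =
  (C₀ : Config n) → (∀ v → v ∈ D → C₀ v ≡ true) →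
  ∃ λ t → ∀ v → iterate r G t C₀ v ≡ true

-- Call an r-set D of nodes good if at least 2r nodes are adjacent to all of D. From a good
-- seed D, the first round blackens these common neighbours and the second blackens D again
-- (each common neighbour is adjacent to every node of D), so by monotonicity the even
-- rounds increase until the process hits a 2-cycle L ↦ M ↦ L. If L or M has a black
-- majority, the next round is all black, as every node has more than n/2 + r neighbours;
-- if both are minorities, double counting the edges between them contradicts the degree
-- bound. Finally, every node v is a common neighbour of (deg v choose r) ≥ n^r / (2r)^r
-- r-sets, while a bad r-set has fewer than 2r common neighbours and a good one at most n,
-- so a constant fraction of the r-sets are good.
module Submission where

open import Data.Bool using (Bool; true; false; _∧_; not)
open import Data.Bool.Properties using (∧-identityʳ; ∧-zeroʳ)
open import Data.Empty using (⊥; ⊥-elim)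
open import Data.Fin using (Fin; zero; suc)
open import Data.Fin.Subset using (Subset; ∣_∣; _⊆_; inside; outside)
open import Data.Fin.Subset.Properties using (_⊆?_)
open import Data.List using (List; []; _∷_; map; _++_; length; filter)
open import Data.List.Membership.Propositional using (_∈_)
open import Data.List.Membership.Propositional.Properties using (∈-map⁻)
open import Data.List.Properties using (length-map; length-++; map-++; map-∘)
open import Data.List.Relation.Unary.All as All using (All; []; _∷_)
import Data.List.Relation.Unary.All.Properties as Allₚ
open import Data.List.Relation.Unary.AllPairs using ([]; _∷_)
open import Data.List.Relation.Unary.Unique.Propositional using (Unique)
import Data.List.Relation.Unary.Unique.Propositional.Properties as Uniqueₚ
open import Data.Nat using (ℕ; zero; suc; _≤_; _<_; _+_; _*_; _^_; _≤?_; z≤n; s≤s; NonZero; >-nonZero)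
open import Data.Nat.Combinatorics using (nCk+nC[k+1]≡[n+1]C[k+1]) renaming (_C_ to _choose_)
open import Data.Nat.DivMod using (_/_; _%_; m≡m%n+[m/n]*n; m%n<n)
open import Data.Nat.ListAction using (sum)
open import Data.Nat.ListAction.Properties using (sum-++)
open import Data.Nat.Properties
open import Data.Nat.Tactic.RingSolver using (solve-∀)
open import Data.Product using (Σ; _×_; ∃; _,_; proj₁; proj₂)
open import Data.Sum using (_⊎_; inj₁; inj₂)
open import Data.Vec using ([]; _∷_; tabulate; lookup)
open import Data.Vec.Properties using (∷-injectiveʳ; lookup∘tabulate; tabulate∘lookup; lookup⇒[]=; []=⇒lookup)
open import Defs
open import Function using (_∘′_; _⇔_; mk⇔; Equivalence)
open import Relation.Binary.PropositionalEquality
open import Relation.Nullary using (yes; no; ¬_)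
open import Relation.Nullary.Decidable using (does; does-⇔; isYes≗does)
import Relation.Unary as U

open import Algebra.Properties.Semiring.Sum +-*-semiring
  using (sum-syntax; sum-cong-≗; ∑-distrib-+; ∑-comm; *-distribˡ-sum; *-distribʳ-sum)

-- Finite sums and counting

𝟙 : Bool → ℕ
𝟙 true  = 1
𝟙 false = 0

count : ∀ {n} → (Fin n → Bool) → ℕ
count {n} P = ∑[ i < n ] 𝟙 (P i)

infix 4 _⊆ᵇ_

_⊆ᵇ_ : ∀ {n} → (Fin n → Bool) → (Fin n → Bool) → Set
P ⊆ᵇ Q = ∀ i → P i ≡ true → Q i ≡ true

∣tabulate∣≡count : ∀ {n} (P : Fin n → Bool) → ∣ tabulate P ∣ ≡ count P
∣tabulate∣≡count {zero}  P = refl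
∣tabulate∣≡count {suc n} P with P zero
... | true  = cong suc (∣tabulate∣≡count (P ∘′ suc))
... | false = ∣tabulate∣≡count (P ∘′ suc)

∑-mono-≤ : ∀ {n} {f g : Fin n → ℕ} → (∀ i → f i ≤ g i) → ∑[ i < n ] f i ≤ ∑[ i < n ] g i
∑-mono-≤ {zero}  f≤g = z≤n
∑-mono-≤ {suc n} f≤g = +-mono-≤ (f≤g zero) (∑-mono-≤ (λ i → f≤g (suc i)))

∑-const : ∀ n c → ∑[ i < n ] c ≡ n * c
∑-const zero    c = refl
∑-const (suc n) c = cong (c +_) (∑-const n c)

∑-𝟙*ʳ : ∀ {n} (P : Fin n → Bool) c → ∑[ i < n ] (𝟙 (P i) * c) ≡ count P * c
∑-𝟙*ʳ P c = sym (*-distribʳ-sum c (λ i → 𝟙 (P i)))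

∑-*ˡ : ∀ {n} c (f : Fin n → ℕ) → ∑[ i < n ] (c * f i) ≡ c * ∑[ i < n ] f i
∑-*ˡ c f = sym (*-distribˡ-sum c f)

𝟙≤1 : ∀ b → 𝟙 b ≤ 1
𝟙≤1 true  = ≤-refl
𝟙≤1 false = z≤n

count≤n : ∀ {n} (P : Fin n → Bool) → count P ≤ n
count≤n {n} P = begin
  count P       ≤⟨ ∑-mono-≤ (λ i → 𝟙≤1 (P i)) ⟩
  ∑[ i < n ] 1  ≡⟨ ∑-const n 1 ⟩
  n * 1         ≡⟨ *-identityʳ n ⟩
  n             ∎
  where open ≤-Reasoning

count-mono : ∀ {n} {P Q : Fin n → Bool} → P ⊆ᵇ Q → count P ≤ count Q
count-mono {P = P} {Q} P⊆Q = ∑-mono-≤ λ i → 𝟙-mono (P i) (Q i) (P⊆Q i)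
  where
    𝟙-mono : ∀ x y → (x ≡ true → y ≡ true) → 𝟙 x ≤ 𝟙 y
    𝟙-mono true  y x⇒y rewrite x⇒y refl = ≤-refl
    𝟙-mono false y x⇒y = z≤n

count-split : ∀ {n} (P Q : Fin n → Bool) →
  count P ≡ count (λ i → P i ∧ Q i) + count (λ i → P i ∧ not (Q i))
count-split P Q = trans (sum-cong-≗ λ i → 𝟙-split (P i) (Q i))
                        (∑-distrib-+ (λ i → 𝟙 (P i ∧ Q i)) (λ i → 𝟙 (P i ∧ not (Q i))))
  where
    𝟙-split : ∀ x y → 𝟙 x ≡ 𝟙 (x ∧ y) + 𝟙 (x ∧ not y)
    𝟙-split true  true  = refl
    𝟙-split true  false = refl
    𝟙-split false y     = refl

count+count-not : ∀ {n} (P : Fin n → Bool) → count P + count (not ∘′ P) ≡ n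
count+count-not {n} P = begin
  count P + count (not ∘′ P)        ≡⟨ ∑-distrib-+ (λ i → 𝟙 (P i)) (λ i → 𝟙 (not (P i))) ⟨
  ∑[ i < n ] (𝟙 (P i) + 𝟙 (not (P i))) ≡⟨ sum-cong-≗ (λ i → 𝟙+𝟙-not (P i)) ⟩
  ∑[ i < n ] 1                      ≡⟨ ∑-const n 1 ⟩
  n * 1                             ≡⟨ *-identityʳ n ⟩
  n                                 ∎
  where
    open ≡-Reasoning
    𝟙+𝟙-not : ∀ x → 𝟙 x + 𝟙 (not x) ≡ 1
    𝟙+𝟙-not true  = refl
    𝟙+𝟙-not false = refl

count≡0⇒false : ∀ {n} (P : Fin n → Bool) → count P ≡ 0 → ∀ i → P i ≡ false
count≡0⇒false P ∑≡0 zero with P zero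
... | false = refl
count≡0⇒false P ∑≡0 (suc i) = count≡0⇒false (P ∘′ suc) (m+n≡0⇒n≡0 (𝟙 (P zero)) ∑≡0) i

⊆ᵇ∧count-≤⇒⊇ᵇ : ∀ {n} {P Q : Fin n → Bool} → P ⊆ᵇ Q → count Q ≤ count P → Q ⊆ᵇ P
⊆ᵇ∧count-≤⇒⊇ᵇ {P = P} {Q} P⊆Q ∣Q∣≤∣P∣ i Qi with P i in Pi
... | true  = refl
... | false = trans (sym (count≡0⇒false _ ∣Q∖P∣≡0 i)) (cong₂ (λ a b → a ∧ not b) Qi Pi)
  where
    𝟙Q∧P≡𝟙P : ∀ j → 𝟙 (Q j ∧ P j) ≡ 𝟙 (P j)
    𝟙Q∧P≡𝟙P j with P j in Pj
    ... | true  = cong 𝟙 (trans (∧-identityʳ (Q j)) (P⊆Q j Pj))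
    ... | false = cong 𝟙 (∧-zeroʳ (Q j))
    ∣Q∖P∣≡0 : count (λ j → Q j ∧ not (P j)) ≡ 0
    ∣Q∖P∣≡0 = n≤0⇒n≡0 (+-cancelˡ-≤ (count P) _ 0 (begin
      count P + count (λ j → Q j ∧ not (P j))
        ≡⟨ cong (_+ count (λ j → Q j ∧ not (P j))) (sum-cong-≗ 𝟙Q∧P≡𝟙P) ⟨
      count (λ j → Q j ∧ P j) + count (λ j → Q j ∧ not (P j))
        ≡⟨ count-split Q P ⟨
      count Q
        ≤⟨ ∣Q∣≤∣P∣ ⟩
      count P
        ≡⟨ +-identityʳ (count P) ⟨
      count P + 0
        ∎))
      where open ≤-Reasoning

∧≡true : ∀ {x y} → x ∧ y ≡ true → x ≡ true × y ≡ true
∧≡true {true} y≡true = refl , y≡true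

count-≤-∧⇒⊆ᵇ : ∀ {n} {P Q : Fin n → Bool} → count P ≤ count (λ i → Q i ∧ P i) → P ⊆ᵇ Q
count-≤-∧⇒⊆ᵇ ∣P∣≤∣Q∧P∣ i Pi =
  proj₁ (∧≡true (⊆ᵇ∧count-≤⇒⊇ᵇ (λ _ → proj₂ ∘′ ∧≡true) ∣P∣≤∣Q∧P∣ i Pi))

⊆ᵇ⇒count-≤-∧ : ∀ {n} {P Q : Fin n → Bool} → P ⊆ᵇ Q → count P ≤ count (λ i → Q i ∧ P i)
⊆ᵇ⇒count-≤-∧ P⊆Q = count-mono λ i Pi → subst (λ b → b ∧ _ ≡ true) (sym (P⊆Q i Pi)) Pi

module _ {A : Set} where

  sum-map-++ : ∀ (f : A → ℕ) xs ys → sum (map f (xs ++ ys)) ≡ sum (map f xs) + sum (map f ys)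
  sum-map-++ f xs ys = trans (cong sum (map-++ f xs ys)) (sum-++ (map f xs) (map f ys))

  sum-map-∘ : ∀ {B : Set} (f : B → ℕ) (h : A → B) xs → sum (map f (map h xs)) ≡ sum (map (f ∘′ h) xs)
  sum-map-∘ f h xs = cong sum (sym (map-∘ xs))

  sum-map-0 : ∀ (xs : List A) → sum (map (λ _ → 0) xs) ≡ 0
  sum-map-0 []       = refl
  sum-map-0 (x ∷ xs) = sum-map-0 xs

  sum-map-cong : ∀ {P : A → Set} {f g : A → ℕ} {xs} → (∀ {x} → P x → f x ≡ g x) → All P xs →
    sum (map f xs) ≡ sum (map g xs)
  sum-map-cong f≗g []         = refl
  sum-map-cong f≗g (px ∷ pxs) = cong₂ _+_ (f≗g px) (sum-map-cong f≗g pxs)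

  sum-map-filter-≤ : ∀ {P : A → Set} (P? : U.Decidable P) (h : A → ℕ) m c xs →
    (∀ x → h x ≤ m) → (∀ x → ¬ P x → h x ≤ c) →
    sum (map h xs) ≤ m * length (filter P? xs) + c * length xs
  sum-map-filter-≤ P? h m c []       h≤m h≤c = z≤n
  sum-map-filter-≤ P? h m c (x ∷ xs) h≤m h≤c with P? x
  ... | yes _  = ≤-trans (+-mono-≤ (h≤m x) (sum-map-filter-≤ P? h m c xs h≤m h≤c))
                   (≤-trans (m≤m+n _ c) (≤-reflexive (regroup m c (length (filter P? xs)) (length xs))))
    where
      regroup : ∀ m c a b → m + (m * a + c * b) + c ≡ m * suc a + c * suc b
      regroup = solve-∀
  ... | no ¬Px = ≤-trans (+-mono-≤ (h≤c x ¬Px) (sum-map-filter-≤ P? h m c xs h≤m h≤c))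
                   (≤-reflexive (regroup m c (length (filter P? xs)) (length xs)))
    where
      regroup : ∀ m c a b → c + (m * a + c * b) ≡ m * a + c * suc b
      regroup = solve-∀

  sum-map-∑ : ∀ {n} (h : A → Fin n → ℕ) xs →
    sum (map (λ x → ∑[ i < n ] h x i) xs) ≡ ∑[ i < n ] sum (map (λ x → h x i) xs)
  sum-map-∑ {n} h []       = sym (trans (∑-const n 0) (*-zeroʳ n))
  sum-map-∑ {n} h (x ∷ xs) = trans (cong (∑[ i < n ] h x i +_) (sum-map-∑ h xs))
                                   (sym (∑-distrib-+ (h x) (λ i → sum (map (λ y → h y i) xs))))

-- Binomial coefficients and r-subsets

choose-pascal : ∀ x r → suc x choose suc r ≡ x choose r + x choose suc r
choose-pascal x r = sym (nCk+nC[k+1]≡[n+1]C[k+1] x r)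

choose-monoˡ-≤ : ∀ r {x y} → x ≤ y → x choose r ≤ y choose r
choose-monoˡ-≤ r {x} x≤y with m≤n⇒∃[o]m+o≡n x≤y
... | k , refl = ≤-+ k
  where
    ≤-+ : ∀ k → x choose r ≤ (x + k) choose r
    ≤-+ zero    = ≤-reflexive (cong (_choose r) (sym (+-identityʳ x)))
    ≤-+ (suc k) = ≤-trans (≤-+ k) (≤-trans (≤-suc (x + k) r) (≤-reflexive (cong (_choose r) (sym (+-suc x k)))))
      where
        ≤-suc : ∀ y r → y choose r ≤ suc y choose r
        ≤-suc y zero    = ≤-refl
        ≤-suc y (suc r) = ≤-trans (m≤n+m (y choose suc r) (y choose r)) (≤-reflexive (sym (choose-pascal y r)))

*-choose≤choose : ∀ k x r → k * (x choose r) ≤ (x + k) choose suc r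
*-choose≤choose zero    x r = z≤n
*-choose≤choose (suc k) x r = begin
  x choose r + k * (x choose r)       ≤⟨ +-mono-≤ (choose-monoˡ-≤ r (m≤m+n x k)) (*-choose≤choose k x r) ⟩
  (x + k) choose r + (x + k) choose suc r ≡⟨ choose-pascal (x + k) r ⟨
  suc (x + k) choose suc r            ≡⟨ cong (_choose suc r) (+-suc x k) ⟨
  (x + suc k) choose suc r            ∎
  where open ≤-Reasoning

^≤choose : ∀ k r → k ^ r ≤ (r * k) choose r
^≤choose k zero    = ≤-refl
^≤choose k (suc r) = begin
  k * k ^ r                ≤⟨ *-monoʳ-≤ k (^≤choose k r) ⟩
  k * ((r * k) choose r)   ≤⟨ *-choose≤choose k (r * k) r ⟩
  (r * k + k) choose suc r ≡⟨ cong (_choose suc r) (+-comm (r * k) k) ⟩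
  (k + r * k) choose suc r ∎
  where open ≤-Reasoning

choose≤^ : ∀ n r → n choose r ≤ n ^ r
choose≤^ zero    zero    = ≤-refl
choose≤^ zero    (suc r) = z≤n
choose≤^ (suc n) zero    = ≤-refl
choose≤^ (suc n) (suc r) = begin
  suc n choose suc r           ≡⟨ choose-pascal n r ⟩
  n choose r + n choose suc r  ≤⟨ +-mono-≤ (choose≤^ n r) (choose≤^ n (suc r)) ⟩
  n ^ r + n * n ^ r            ≤⟨ +-monoʳ-≤ (n ^ r) (*-monoʳ-≤ n (^-monoˡ-≤ r (n≤1+n n))) ⟩
  n ^ r + n * suc n ^ r        ≤⟨ +-monoˡ-≤ (n * suc n ^ r) (^-monoˡ-≤ r (n≤1+n n)) ⟩
  suc n ^ r + n * suc n ^ r    ∎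
  where open ≤-Reasoning

^-distribʳ-* : ∀ a b r → (a * b) ^ r ≡ a ^ r * b ^ r
^-distribʳ-* a b zero    = refl
^-distribʳ-* a b (suc r) = trans (cong (a * b *_) (^-distribʳ-* a b r)) (interchange a b (a ^ r) (b ^ r))
  where
    interchange : ∀ a b x y → a * b * (x * y) ≡ a * x * (b * y)
    interchange = solve-∀

-- With k = ⌊m / r⌋ we have n ≤ 2rk and rk ≤ m, so n ^ r ≤ (2r) ^ r k ^ r ≤ (2r) ^ r (m choose r).
^≤scaled-choose : ∀ s m n → n + 2 * suc s ≤ 2 * m → n ^ suc s ≤ (2 * suc s) ^ suc s * (m choose suc s)
^≤scaled-choose s m n n+2r≤2m = begin
  n ^ r                             ≤⟨ ^-monoˡ-≤ r n≤2rk ⟩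
  (2 * r * k) ^ r                   ≡⟨ ^-distribʳ-* (2 * r) k r ⟩
  (2 * r) ^ r * k ^ r               ≤⟨ *-monoʳ-≤ ((2 * r) ^ r) (^≤choose k r) ⟩
  (2 * r) ^ r * ((r * k) choose r)  ≤⟨ *-monoʳ-≤ ((2 * r) ^ r) (choose-monoˡ-≤ r rk≤m) ⟩
  (2 * r) ^ r * (m choose r)        ∎
  where
    open ≤-Reasoning
    r = suc s
    k = m / r
    ρ = m % r
    m≡ρ+kr : m ≡ ρ + k * r
    m≡ρ+kr = m≡m%n+[m/n]*n m r
    rk≤m : r * k ≤ m
    rk≤m = ≤-trans (≤-reflexive (*-comm r k)) (≤-trans (m≤n+m (k * r) ρ) (≤-reflexive (sym m≡ρ+kr)))
    n≤2rk : n ≤ 2 * r * k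
    n≤2rk = +-cancelˡ-≤ (2 * r) n (2 * r * k) (begin
      2 * r + n          ≡⟨ +-comm (2 * r) n ⟩
      n + 2 * r          ≤⟨ n+2r≤2m ⟩
      2 * m              ≡⟨ cong (2 *_) m≡ρ+kr ⟩
      2 * (ρ + k * r)    ≤⟨ *-monoʳ-≤ 2 (+-monoˡ-≤ (k * r) (<⇒≤ (m%n<n m r))) ⟩
      2 * (r + k * r)    ≡⟨ distrib r k ⟩
      2 * r + 2 * r * k  ∎)
      where
        distrib : ∀ r k → 2 * (r + k * r) ≡ 2 * r + 2 * r * k
        distrib = solve-∀

subsets : ∀ n → ℕ → List (Subset n)
subsets zero    zero    = [] ∷ []
subsets zero    (suc r) = []
subsets (suc n) zero    = map (outside ∷_) (subsets n zero)
subsets (suc n) (suc r) = map (inside ∷_) (subsets n r) ++ map (outside ∷_) (subsets n (suc r))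

subsets-unique : ∀ n r → Unique (subsets n r)
subsets-unique zero    zero    = [] ∷ []
subsets-unique zero    (suc r) = []
subsets-unique (suc n) zero    = Uniqueₚ.map⁺ ∷-injectiveʳ (subsets-unique n zero)
subsets-unique (suc n) (suc r) =
  Uniqueₚ.++⁺ (Uniqueₚ.map⁺ ∷-injectiveʳ (subsets-unique n r))
              (Uniqueₚ.map⁺ ∷-injectiveʳ (subsets-unique n (suc r))) disjoint
  where
    disjoint : ∀ {D} → ¬ (D ∈ map (inside ∷_) (subsets n r) × D ∈ map (outside ∷_) (subsets n (suc r)))
    disjoint (D∈ins , D∈outs) with ∈-map⁻ (inside ∷_) D∈ins | ∈-map⁻ (outside ∷_) D∈outs
    ... | _ , _ , refl | _ , _ , ()

subsets-size : ∀ n r → All (λ D → ∣ D ∣ ≡ r) (subsets n r)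
subsets-size zero    zero    = refl ∷ []
subsets-size zero    (suc r) = []
subsets-size (suc n) zero    = Allₚ.map⁺ (subsets-size n zero)
subsets-size (suc n) (suc r) =
  Allₚ.++⁺ (Allₚ.map⁺ (All.map (cong suc) (subsets-size n r))) (Allₚ.map⁺ (subsets-size n (suc r)))

length-subsets : ∀ n r → length (subsets n r) ≡ n choose r
length-subsets zero    zero    = refl
length-subsets zero    (suc r) = refl
length-subsets (suc n) zero    = trans (length-map (outside ∷_) (subsets n zero)) (length-subsets n zero)
length-subsets (suc n) (suc r) = begin
  length (map (inside ∷_) (subsets n r) ++ map (outside ∷_) (subsets n (suc r)))
    ≡⟨ length-++ (map (inside ∷_) (subsets n r)) ⟩
  length (map (inside ∷_) (subsets n r)) + length (map (outside ∷_) (subsets n (suc r)))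
    ≡⟨ cong₂ _+_ (trans (length-map _ (subsets n r)) (length-subsets n r))
                 (trans (length-map _ (subsets n (suc r))) (length-subsets n (suc r))) ⟩
  n choose r + n choose suc r
    ≡⟨ choose-pascal n r ⟨
  suc n choose suc r
    ∎
  where open ≡-Reasoning

sum-subsets-suc : ∀ n r (f : Subset (suc n) → ℕ) → sum (map f (subsets (suc n) (suc r)))
  ≡ sum (map (f ∘′ (inside ∷_)) (subsets n r)) + sum (map (f ∘′ (outside ∷_)) (subsets n (suc r)))
sum-subsets-suc n r f = trans (sum-map-++ f (map (inside ∷_) (subsets n r)) _)
  (cong₂ _+_ (sum-map-∘ f (inside ∷_) (subsets n r)) (sum-map-∘ f (outside ∷_) (subsets n (suc r))))

sum-subsets-⊆ : ∀ n r (g : Subset n) → sum (map (λ D → 𝟙 (does (D ⊆? g))) (subsets n r)) ≡ ∣ g ∣ choose r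
sum-subsets-⊆ zero    zero    []      = refl
sum-subsets-⊆ zero    (suc r) []      = refl
sum-subsets-⊆ (suc n) zero    (x ∷ g) =
  trans (sum-map-∘ (λ D → 𝟙 (does (D ⊆? x ∷ g))) (outside ∷_) (subsets n zero)) (sum-subsets-⊆ n zero g)
sum-subsets-⊆ (suc n) (suc r) (inside ∷ g) = begin
  sum (map (λ D → 𝟙 (does (D ⊆? inside ∷ g))) (subsets (suc n) (suc r)))
    ≡⟨ sum-subsets-suc n r (λ D → 𝟙 (does (D ⊆? inside ∷ g))) ⟩
  sum (map (λ D → 𝟙 (does (D ⊆? g))) (subsets n r)) + sum (map (λ D → 𝟙 (does (D ⊆? g))) (subsets n (suc r)))
    ≡⟨ cong₂ _+_ (sum-subsets-⊆ n r g) (sum-subsets-⊆ n (suc r) g) ⟩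
  ∣ g ∣ choose r + ∣ g ∣ choose suc r
    ≡⟨ choose-pascal ∣ g ∣ r ⟨
  suc ∣ g ∣ choose suc r
    ∎
  where open ≡-Reasoning
sum-subsets-⊆ (suc n) (suc r) (outside ∷ g) = begin
  sum (map (λ D → 𝟙 (does (D ⊆? outside ∷ g))) (subsets (suc n) (suc r)))
    ≡⟨ sum-subsets-suc n r (λ D → 𝟙 (does (D ⊆? outside ∷ g))) ⟩
  sum (map (λ _ → 0) (subsets n r)) + sum (map (λ D → 𝟙 (does (D ⊆? g))) (subsets n (suc r)))
    ≡⟨ cong₂ _+_ (sum-map-0 (subsets n r)) (sum-subsets-⊆ n (suc r) g) ⟩
  ∣ g ∣ choose suc r
    ∎
  where open ≡-Reasoning

∣D∣≡count : ∀ {n} (D : Subset n) → ∣ D ∣ ≡ count (lookup D)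
∣D∣≡count D = trans (cong ∣_∣ (sym (tabulate∘lookup D))) (∣tabulate∣≡count (lookup D))

⊆tabulate⇔⊆ᵇ : ∀ {n} (D : Subset n) (g : Fin n → Bool) → D ⊆ tabulate g ⇔ lookup D ⊆ᵇ g
⊆tabulate⇔⊆ᵇ D g = mk⇔
  (λ D⊆g i Di → trans (sym (lookup∘tabulate g i)) ([]=⇒lookup (D⊆g (lookup⇒[]= i D Di))))
  (λ D⊆g {i} i∈D → lookup⇒[]= i (tabulate g)
                     (trans (lookup∘tabulate g i) (D⊆g i ([]=⇒lookup i∈D))))

bounded⇒stalls : ∀ (c : ℕ → ℕ) m → (∀ k → c k ≤ m) → ∃ λ k → c (suc k) ≤ c k
bounded⇒stalls c m bounded with grows-or-stalls (suc m)
  where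
    grows-or-stalls : ∀ j → j ≤ c j ⊎ ∃ (λ k → c (suc k) ≤ c k)
    grows-or-stalls zero = inj₁ z≤n
    grows-or-stalls (suc j) with grows-or-stalls j
    ... | inj₂ stall = inj₂ stall
    ... | inj₁ j≤cj with c (suc j) ≤? c j
    ...   | yes stall = inj₂ (j , stall)
    ...   | no  grows = inj₁ (<-≤-trans (s≤s j≤cj) (≰⇒> grows))
... | inj₁ m<c = ⊥-elim (<⇒≱ m<c (bounded (suc m)))
... | inj₂ stall = stall

module _ (s : ℕ) where

  private
    r = suc s

  two-cycle-small-a : ∀ a β u → suc a ≤ 2 * s →
    (2 * r + β) * ((a + suc (a + u)) + 2 * r) ≤ 2 * (suc (a + u) * s) + 2 * ((2 * r + β) * a) → ⊥
  two-cycle-small-a a β u a<2s ineq = m+1+n≰m _ (begin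
    2 * ((2 * s + u) * s) + suc (10 * s + 5 + 2 * u + β * (2 * s + 3 + u))
      ≡⟨ expand-rhs s β u ⟩
    (2 * r + β) * (2 * s + 3 + u)
      ≤⟨ +-cancelˡ-≤ (2 * ((2 * r + β) * a)) _ _ (begin
           2 * ((2 * r + β) * a) + (2 * r + β) * (2 * s + 3 + u)
             ≡⟨ expand-lhs s a β u ⟨
           (2 * r + β) * ((a + suc (a + u)) + 2 * r)
             ≤⟨ ineq ⟩
           2 * (suc (a + u) * s) + 2 * ((2 * r + β) * a)
             ≡⟨ +-comm (2 * (suc (a + u) * s)) _ ⟩
           2 * ((2 * r + β) * a) + 2 * (suc (a + u) * s)
             ∎) ⟩
    2 * (suc (a + u) * s)
      ≤⟨ *-monoʳ-≤ 2 (*-monoˡ-≤ s (+-monoˡ-≤ u a<2s)) ⟩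
    2 * ((2 * s + u) * s)
      ∎)
    where
      open ≤-Reasoning
      expand-lhs : ∀ s a β u → (2 * suc s + β) * ((a + suc (a + u)) + 2 * suc s)
        ≡ 2 * ((2 * suc s + β) * a) + (2 * suc s + β) * (2 * s + 3 + u)
      expand-lhs = solve-∀
      expand-rhs : ∀ s β u → 2 * ((2 * s + u) * s) + suc (10 * s + 5 + 2 * u + β * (2 * s + 3 + u))
        ≡ (2 * suc s + β) * (2 * s + 3 + u)
      expand-rhs = solve-∀

  two-cycle-large-a : ∀ α β u w →
    (2 * r + β) * (((2 * s + α) + suc ((2 * s + α) + u)) + 2 * r)
      ≤ 2 * (suc ((2 * s + α) + u) * s) + 2 * ((2 * r + β) * (2 * s + α)) →
    (2 * s + α) * (((2 * r + β) + suc ((2 * r + β) + w)) + 2 * r)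
      ≤ 2 * (suc ((2 * r + β) + w) * s) + 2 * ((2 * s + α) * (2 * r + β)) → ⊥
  two-cycle-large-a α β u w ineq₁ ineq₂ =
    m+1+n≰m _ (≤-trans (≤-reflexive (sum-of-sides s α β u w)) (+-mono-≤ ineq₁ ineq₂))
    where
      sum-of-sides : ∀ s α β u w →
        (2 * (suc ((2 * s + α) + u) * s) + 2 * ((2 * suc s + β) * (2 * s + α)))
        + (2 * (suc ((2 * suc s + β) + w) * s) + 2 * ((2 * s + α) * (2 * suc s + β)))
        + suc (8 * s + 5 + 3 * α + 3 * β + 2 * u + β * u + α * w)
        ≡ (2 * suc s + β) * (((2 * s + α) + suc ((2 * s + α) + u)) + 2 * suc s)
        + (2 * s + α) * (((2 * suc s + β) + suc ((2 * suc s + β) + w)) + 2 * suc s)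
      sum-of-sides = solve-∀

  -- Write a' = a + 1 + u, b' = b + 1 + w and b = 2r + β. If a < 2s the first inequality
  -- fails on its own; otherwise, with a = 2s + α, their sum fails, its two sides differing
  -- by a polynomial with positive coefficients.
  minority-two-cycle-impossible : ∀ n a a' b b' → n ≡ a + a' → n ≡ b + b' → a < a' → b < b' →
    2 * r ≤ b →
    b * (n + 2 * r) ≤ 2 * (a' * s) + 2 * (b * a) →
    a * (n + 2 * r) ≤ 2 * (b' * s) + 2 * (a * b) → ⊥
  minority-two-cycle-impossible n a a' b b' n≡a+a' n≡b+b' a<a' b<b' 2r≤b ineq₁ ineq₂ =
    cases a<a' b<b' 2r≤b (subst (λ m → b * (m + 2 * r) ≤ _) n≡a+a' ineq₁)
                         (subst (λ m → a * (m + 2 * r) ≤ _) n≡b+b' ineq₂)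
    where
      cases : ∀ {a a' b b'} → a < a' → b < b' → 2 * r ≤ b →
        b * ((a + a') + 2 * r) ≤ 2 * (a' * s) + 2 * (b * a) →
        a * ((b + b') + 2 * r) ≤ 2 * (b' * s) + 2 * (a * b) → ⊥
      cases {a} a<a' b<b' 2r≤b ineq₁ ineq₂
        with m≤n⇒∃[o]m+o≡n a<a' | m≤n⇒∃[o]m+o≡n b<b' | m≤n⇒∃[o]m+o≡n 2r≤b
      ... | u , refl | w , refl | β , refl with 2 * s ≤? a
      ...   | no  a≱2s = two-cycle-small-a a β u (≰⇒> a≱2s) ineq₁
      ...   | yes a≥2s with m≤n⇒∃[o]m+o≡n a≥2s
      ...     | α , refl = two-cycle-large-a α β u w ineq₁ ineq₂

absorb-error : ∀ n X Q Y c → .{{NonZero n}} → n * X ≤ Q * (n * Y + c * X) → 2 * c * Q ≤ n → X ≤ 2 * Q * Y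
absorb-error n X Q Y c nX≤ 2cQ≤n = *-cancelˡ-≤ n (+-cancelʳ-≤ (n * X) _ _ (begin
  n * X + n * X              ≡⟨ cong (n * X +_) (+-identityʳ (n * X)) ⟨
  2 * (n * X)                ≤⟨ *-monoʳ-≤ 2 nX≤ ⟩
  2 * (Q * (n * Y + c * X))  ≡⟨ expand n X Q Y c ⟩
  n * (2 * Q * Y) + 2 * c * Q * X ≤⟨ +-monoʳ-≤ (n * (2 * Q * Y)) (*-monoˡ-≤ X 2cQ≤n) ⟩
  n * (2 * Q * Y) + n * X    ∎))
  where
    open ≤-Reasoning
    expand : ∀ n X Q Y c → 2 * (Q * (n * Y + c * X)) ≡ n * (2 * Q * Y) + 2 * c * Q * X
    expand = solve-∀

-- Bootstrap percolation

countNbrs : ∀ {n} → Graph n → (Fin n → Bool) → Fin n → ℕ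
countNbrs G P v = count (λ u → adj G v u ∧ P u)

blackNbrs≡countNbrs : ∀ {n} (G : Graph n) C v → blackNbrs G C v ≡ countNbrs G C v
blackNbrs≡countNbrs G C v = ∣tabulate∣≡count (λ u → adj G v u ∧ C u)

handshake : ∀ {n} (G : Graph n) (P Q : Fin n → Bool) →
  ∑[ u < n ] (𝟙 (P u) * countNbrs G Q u) ≡ ∑[ v < n ] (𝟙 (Q v) * countNbrs G P v)
handshake {n} G P Q = begin
  ∑[ u < n ] (𝟙 (P u) * countNbrs G Q u)
    ≡⟨ sum-cong-≗ (λ u → *-distribˡ-sum (𝟙 (P u)) (λ v → 𝟙 (adj G u v ∧ Q v))) ⟩
  ∑[ u < n ] ∑[ v < n ] (𝟙 (P u) * 𝟙 (adj G u v ∧ Q v))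
    ≡⟨ ∑-comm (λ u v → 𝟙 (P u) * 𝟙 (adj G u v ∧ Q v)) ⟩
  ∑[ v < n ] ∑[ u < n ] (𝟙 (P u) * 𝟙 (adj G u v ∧ Q v))
    ≡⟨ sum-cong-≗ (λ v → sum-cong-≗ (λ u →
         trans (cong (λ a → 𝟙 (P u) * 𝟙 (a ∧ Q v)) (symm G u v)) (𝟙-swap (P u) (adj G v u) (Q v)))) ⟩
  ∑[ v < n ] ∑[ u < n ] (𝟙 (Q v) * 𝟙 (adj G v u ∧ P u))
    ≡⟨ sum-cong-≗ (λ v → *-distribˡ-sum (𝟙 (Q v)) (λ u → 𝟙 (adj G v u ∧ P u))) ⟨
  ∑[ v < n ] (𝟙 (Q v) * countNbrs G P v)
    ∎
  where
    open ≡-Reasoning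
    𝟙-swap : ∀ x a y → 𝟙 x * 𝟙 (a ∧ y) ≡ 𝟙 y * 𝟙 (a ∧ x)
    𝟙-swap x     false y     = trans (*-zeroʳ (𝟙 x)) (sym (*-zeroʳ (𝟙 y)))
    𝟙-swap true  true  true  = refl
    𝟙-swap true  true  false = refl
    𝟙-swap false true  true  = refl
    𝟙-swap false true  false = refl

module _ {n} (r : ℕ) (G : Graph n) where

  stepConfig≡true⇒ : ∀ {C v} → stepConfig r G C v ≡ true → r ≤ countNbrs G C v
  stepConfig≡true⇒ {C} {v} black with r ≤? blackNbrs G C v
  ... | yes r≤ = subst (r ≤_) (blackNbrs≡countNbrs G C v) r≤

  stepConfig≡false⇒ : ∀ {C v} → stepConfig r G C v ≡ false → countNbrs G C v < r
  stepConfig≡false⇒ {C} {v} white with r ≤? blackNbrs G C v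
  ... | no r≰ = subst (_< r) (blackNbrs≡countNbrs G C v) (≰⇒> r≰)

  ≤⇒stepConfig≡true : ∀ {C v} → r ≤ countNbrs G C v → stepConfig r G C v ≡ true
  ≤⇒stepConfig≡true {C} {v} r≤ with r ≤? blackNbrs G C v
  ... | yes _ = refl
  ... | no r≰ = ⊥-elim (r≰ (subst (r ≤_) (sym (blackNbrs≡countNbrs G C v)) r≤))

  stepConfig-mono : ∀ {C C'} → C ⊆ᵇ C' → stepConfig r G C ⊆ᵇ stepConfig r G C'
  stepConfig-mono {C} {C'} C⊆C' v black =
    ≤⇒stepConfig≡true (≤-trans (stepConfig≡true⇒ black) (count-mono N∧C⊆N∧C'))
    where
      N∧C⊆N∧C' : (λ u → adj G v u ∧ C u) ⊆ᵇ (λ u → adj G v u ∧ C' u)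
      N∧C⊆N∧C' u Nu∧Cu with ∧≡true Nu∧Cu
      ... | Nu , Cu = subst₂ (λ a b → a ∧ b ≡ true) (sym Nu) (sym (C⊆C' u Cu)) refl

  iterate-mono : ∀ t {C C'} → C ⊆ᵇ C' → iterate r G t C ⊆ᵇ iterate r G t C'
  iterate-mono zero    C⊆C' = C⊆C'
  iterate-mono (suc t) C⊆C' = stepConfig-mono (iterate-mono t C⊆C')

  good? : U.Decidable (λ (D : Subset n) → 2 * r ≤ count (stepConfig r G (lookup D)))
  good? D = 2 * r ≤? count (stepConfig r G (lookup D))

  goodSeeds : List (Subset n)
  goodSeeds = filter good? (subsets n r)

  stepConfig≡⊆nbhd : ∀ {D : Subset n} → ∣ D ∣ ≡ r → ∀ v →
    stepConfig r G (lookup D) v ≡ does (D ⊆? nbhd G v)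
  stepConfig≡⊆nbhd {D} ∣D∣≡r v =
    trans (isYes≗does (r ≤? blackNbrs G (lookup D) v)) (does-⇔ r≤⇔⊆ (r ≤? _) (D ⊆? nbhd G v))
    where
      r≡count : r ≡ count (lookup D)
      r≡count = trans (sym ∣D∣≡r) (∣D∣≡count D)
      r≤⇔⊆ : r ≤ blackNbrs G (lookup D) v ⇔ D ⊆ nbhd G v
      r≤⇔⊆ = mk⇔ r≤⇒⊆ ⊆⇒r≤
        where
          r≤⇒⊆ : r ≤ blackNbrs G (lookup D) v → D ⊆ nbhd G v
          r≤⇒⊆ r≤ = Equivalence.from (⊆tabulate⇔⊆ᵇ D (adj G v))
            (count-≤-∧⇒⊆ᵇ (subst₂ _≤_ r≡count (blackNbrs≡countNbrs G (lookup D) v) r≤))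
          ⊆⇒r≤ : D ⊆ nbhd G v → r ≤ blackNbrs G (lookup D) v
          ⊆⇒r≤ D⊆N = subst₂ _≤_ (sym r≡count) (sym (blackNbrs≡countNbrs G (lookup D) v))
            (⊆ᵇ⇒count-≤-∧ (Equivalence.to (⊆tabulate⇔⊆ᵇ D (adj G v)) D⊆N))

  sum-stepConfig-subsets :
    sum (map (λ D → count (stepConfig r G (lookup D))) (subsets n r)) ≡ ∑[ v < n ] (degree G v choose r)
  sum-stepConfig-subsets = begin
    sum (map (λ D → count (stepConfig r G (lookup D))) (subsets n r))
      ≡⟨ sum-map-∑ (λ D v → 𝟙 (stepConfig r G (lookup D) v)) (subsets n r) ⟩
    ∑[ v < n ] sum (map (λ D → 𝟙 (stepConfig r G (lookup D) v)) (subsets n r))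
      ≡⟨ sum-cong-≗ (λ v →
           sum-map-cong (λ {D} ∣D∣≡r → cong 𝟙 (stepConfig≡⊆nbhd {D} ∣D∣≡r v)) (subsets-size n r)) ⟩
    ∑[ v < n ] sum (map (λ D → 𝟙 (does (D ⊆? nbhd G v))) (subsets n r))
      ≡⟨ sum-cong-≗ (λ v → sum-subsets-⊆ n r (nbhd G v)) ⟩
    ∑[ v < n ] (degree G v choose r)
      ∎
    where open ≡-Reasoning

  module _ (min-degree : ∀ v → n + 2 * r ≤ 2 * degree G v) where

    -- A node sees at most n / 2 white nodes but has more than n / 2 + r neighbours.
    majority⇒stepConfig≡true : ∀ C → count (not ∘′ C) ≤ count C → ∀ v → stepConfig r G C v ≡ true
    majority⇒stepConfig≡true C white≤black v =
      ≤⇒stepConfig≡true (*-cancelˡ-≤ 2 (+-cancelˡ-≤ (2 * w) _ _ (begin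
        2 * w + 2 * r
          ≤⟨ +-monoˡ-≤ (2 * r) (+-mono-≤ white≤black (≤-reflexive (+-identityʳ w))) ⟩
        (count C + w) + 2 * r
          ≡⟨ cong (_+ 2 * r) (count+count-not C) ⟩
        n + 2 * r
          ≤⟨ min-degree v ⟩
        2 * degree G v
          ≡⟨ cong (2 *_) (trans (∣tabulate∣≡count (adj G v)) (count-split (adj G v) C)) ⟩
        2 * (countNbrs G C v + countNbrs G (not ∘′ C) v)
          ≤⟨ *-monoʳ-≤ 2 (+-monoʳ-≤ (countNbrs G C v) white-nbrs≤w) ⟩
        2 * (countNbrs G C v + w)
          ≡⟨ *-distribˡ-+ 2 (countNbrs G C v) w ⟩
        2 * countNbrs G C v + 2 * w
          ≡⟨ +-comm (2 * countNbrs G C v) (2 * w) ⟩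
        2 * w + 2 * countNbrs G C v
          ∎)))
      where
        open ≤-Reasoning
        w = count (not ∘′ C)
        white-nbrs≤w : countNbrs G (not ∘′ C) v ≤ w
        white-nbrs≤w = count-mono {P = λ u → adj G v u ∧ not (C u)} (λ _ → proj₂ ∘′ ∧≡true)

module _ {n} (s : ℕ) (G : Graph n) (min-degree : ∀ v → n + 2 * suc s ≤ 2 * degree G v) where

  cross-edge-bound : ∀ (S T : Config n) → (∀ v → T v ≡ false → countNbrs G S v ≤ s) →
    count S * (n + 2 * suc s) ≤ 2 * (count (not ∘′ T) * s) + 2 * (count S * count T)
  cross-edge-bound S T sparse = begin
    count S * (n + 2 * suc s)
      ≡⟨ ∑-𝟙*ʳ S (n + 2 * suc s) ⟨
    ∑[ u < n ] (𝟙 (S u) * (n + 2 * suc s))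
      ≤⟨ ∑-mono-≤ (λ u → *-monoʳ-≤ (𝟙 (S u)) (≤-trans (min-degree u) (*-monoʳ-≤ 2 (degree≤ u)))) ⟩
    ∑[ u < n ] (𝟙 (S u) * (2 * (countNbrs G (not ∘′ T) u + count T)))
      ≡⟨ sum-cong-≗ (λ u → distrib (𝟙 (S u)) (countNbrs G (not ∘′ T) u) (count T)) ⟩
    ∑[ u < n ] (2 * (𝟙 (S u) * countNbrs G (not ∘′ T) u) + 2 * (𝟙 (S u) * count T))
      ≡⟨ ∑-distrib-+ (λ u → 2 * (𝟙 (S u) * countNbrs G (not ∘′ T) u)) (λ u → 2 * (𝟙 (S u) * count T)) ⟩
    ∑[ u < n ] (2 * (𝟙 (S u) * countNbrs G (not ∘′ T) u)) + ∑[ u < n ] (2 * (𝟙 (S u) * count T))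
      ≡⟨ cong₂ _+_ (∑-*ˡ 2 (λ u → 𝟙 (S u) * countNbrs G (not ∘′ T) u))
                   (trans (∑-*ˡ 2 (λ u → 𝟙 (S u) * count T)) (cong (2 *_) (∑-𝟙*ʳ S (count T)))) ⟩
    2 * ∑[ u < n ] (𝟙 (S u) * countNbrs G (not ∘′ T) u) + 2 * (count S * count T)
      ≡⟨ cong (λ x → 2 * x + 2 * (count S * count T)) (handshake G S (not ∘′ T)) ⟩
    2 * ∑[ v < n ] (𝟙 (not (T v)) * countNbrs G S v) + 2 * (count S * count T)
      ≤⟨ +-monoˡ-≤ (2 * (count S * count T)) (*-monoʳ-≤ 2 (∑-mono-≤ outside-T)) ⟩
    2 * ∑[ v < n ] (𝟙 (not (T v)) * s) + 2 * (count S * count T)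
      ≡⟨ cong (λ x → 2 * x + 2 * (count S * count T)) (∑-𝟙*ʳ (not ∘′ T) s) ⟩
    2 * (count (not ∘′ T) * s) + 2 * (count S * count T)
      ∎
    where
      open ≤-Reasoning
      distrib : ∀ x y z → x * (2 * (y + z)) ≡ 2 * (x * y) + 2 * (x * z)
      distrib = solve-∀
      degree≤ : ∀ u → degree G u ≤ countNbrs G (not ∘′ T) u + count T
      degree≤ u = begin
        degree G u
          ≡⟨ trans (∣tabulate∣≡count (adj G u)) (count-split (adj G u) T) ⟩
        countNbrs G T u + countNbrs G (not ∘′ T) u
          ≤⟨ +-monoˡ-≤ _ (count-mono {P = λ v → adj G u v ∧ T v} (λ v → proj₂ ∘′ ∧≡true)) ⟩
        count T + countNbrs G (not ∘′ T) u
          ≡⟨ +-comm (count T) _ ⟩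
        countNbrs G (not ∘′ T) u + count T
          ∎
      outside-T : ∀ v → 𝟙 (not (T v)) * countNbrs G S v ≤ 𝟙 (not (T v)) * s
      outside-T v with T v in Tv
      ... | true  = z≤n
      ... | false = *-monoʳ-≤ 1 (sparse v Tv)

  private
    round : Config n → Config n
    round = stepConfig (suc s) G

  two-cycle⇒majority : ∀ L → round (round L) ⊆ᵇ L → 2 * suc s ≤ count (round L) →
    count (not ∘′ L) ≤ count L ⊎ count (not ∘′ round L) ≤ count (round L)
  two-cycle⇒majority L cycle dense with count (not ∘′ L) ≤? count L | count (not ∘′ M) ≤? count M
    where M = round L
  ... | yes L-majority | _              = inj₁ L-majority
  ... | no  _          | yes M-majority = inj₂ M-majority
  ... | no  L-minority | no  M-minority = ⊥-elim (minority-two-cycle-impossible s n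
        (count L) (count (not ∘′ L)) (count M) (count (not ∘′ M))
        (sym (count+count-not L)) (sym (count+count-not M)) (≰⇒> L-minority) (≰⇒> M-minority) dense
        (cross-edge-bound M L M-sparse-outside-L) (cross-edge-bound L M L-sparse-outside-M))
    where
      M = round L
      M-sparse-outside-L : ∀ v → L v ≡ false → countNbrs G M v ≤ s
      M-sparse-outside-L v Lv with round M v in M²v
      ... | false = ≤-pred (stepConfig≡false⇒ (suc s) G M²v)
      ... | true with trans (sym (cycle v M²v)) Lv
      ...   | ()
      L-sparse-outside-M : ∀ v → M v ≡ false → countNbrs G L v ≤ s
      L-sparse-outside-M v Mv = ≤-pred (stepConfig≡false⇒ (suc s) G Mv)

  module _ (S₀ : Config n) (small : count S₀ ≤ suc s) (dense : 2 * suc s ≤ count (round S₀)) where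

    -- k * 2 rather than 2 * k, so that evens (suc k) unfolds to two rounds after evens k.
    private
      evens : ℕ → Config n
      evens k = iterate (suc s) G (k * 2) S₀

    -- Every node black in round S₀ is adjacent to all of S₀, since |S₀| ≤ r.
    seed⊆round² : S₀ ⊆ᵇ round (round S₀)
    seed⊆round² d S₀d = ≤⇒stepConfig≡true (suc s) G (begin
      suc s                  ≤⟨ m≤m+n (suc s) (suc s + 0) ⟩
      2 * suc s              ≤⟨ dense ⟩
      count (round S₀)       ≤⟨ ⊆ᵇ⇒count-≤-∧ round-S₀⊆Nd ⟩
      countNbrs G (round S₀) d ∎)
      where
        open ≤-Reasoning
        round-S₀⊆Nd : round S₀ ⊆ᵇ adj G d
        round-S₀⊆Nd u black = trans (symm G d u)
          (count-≤-∧⇒⊆ᵇ (≤-trans small (stepConfig≡true⇒ (suc s) G black)) d S₀d)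

    evens-increasing : ∀ k → evens k ⊆ᵇ evens (suc k)
    evens-increasing zero    = seed⊆round²
    evens-increasing (suc k) =
      stepConfig-mono (suc s) G (stepConfig-mono (suc s) G (evens-increasing k))

    seed⊆evens : ∀ k → S₀ ⊆ᵇ evens k
    seed⊆evens zero    v S₀v = S₀v
    seed⊆evens (suc k) v S₀v = evens-increasing k v (seed⊆evens k v S₀v)

    percolates-from-seed : ∃ λ t → ∀ v → iterate (suc s) G t S₀ v ≡ true
    percolates-from-seed with bounded⇒stalls (count ∘′ evens) n (λ k → count≤n (evens k))
    ... | k , stall
      with two-cycle⇒majority (evens k) (⊆ᵇ∧count-≤⇒⊇ᵇ (evens-increasing k) stall)
             (≤-trans dense (count-mono (stepConfig-mono (suc s) G (seed⊆evens k))))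
    ...   | inj₁ L-majority =
      suc (k * 2) , majority⇒stepConfig≡true (suc s) G min-degree (evens k) L-majority
    ...   | inj₂ M-majority =
      suc k * 2 , majority⇒stepConfig≡true (suc s) G min-degree (round (evens k)) M-majority

  seed⇒dynamo : ∀ (D : Subset n) → ∣ D ∣ ≡ suc s → 2 * suc s ≤ count (round (lookup D)) →
    Dynamo (suc s) G D
  seed⇒dynamo D ∣D∣≡r dense C₀ D-black
    with percolates-from-seed (lookup D) (≤-reflexive (trans (sym (∣D∣≡count D)) ∣D∣≡r)) dense
  ... | t , all-black = t , λ v → iterate-mono (suc s) G t D⊆C₀ v (all-black v)
    where
      D⊆C₀ : lookup D ⊆ᵇ C₀
      D⊆C₀ v Dv = D-black v (lookup⇒[]= v D Dv)

  goodSeeds-dynamos : All (λ D → ∣ D ∣ ≡ suc s × Dynamo (suc s) G D) (goodSeeds (suc s) G)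
  goodSeeds-dynamos = All.map (λ (∣D∣≡r , dense) → ∣D∣≡r , seed⇒dynamo _ ∣D∣≡r dense)
    (All.zip (Allₚ.filter⁺ (good? (suc s) G) (subsets-size n (suc s)) ,
              Allₚ.all-filter (good? (suc s) G) (subsets n (suc s))))

  many-goodSeeds : 2 * (2 * suc s) * (2 * suc s) ^ suc s ≤ n →
    n ^ suc s ≤ 2 * (2 * suc s) ^ suc s * length (goodSeeds (suc s) G)
  many-goodSeeds N≤n = absorb-error n (n ^ r) Q (length (goodSeeds r G)) (2 * r) ⦃ n≢0 ⦄ (begin
    n * n ^ r
      ≡⟨ ∑-const n (n ^ r) ⟨
    ∑[ v < n ] (n ^ r)
      ≤⟨ ∑-mono-≤ {n} (λ v → ^≤scaled-choose s (degree G v) n (min-degree v)) ⟩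
    ∑[ v < n ] (Q * (degree G v choose r))
      ≡⟨ ∑-*ˡ Q (λ v → degree G v choose r) ⟩
    Q * ∑[ v < n ] (degree G v choose r)
      ≡⟨ cong (Q *_) (sum-stepConfig-subsets r G) ⟨
    Q * sum (map (λ D → count (round (lookup D))) (subsets n r))
      ≤⟨ *-monoʳ-≤ Q (sum-map-filter-≤ (good? r G) _ n (2 * r) (subsets n r)
                        (λ D → count≤n (round (lookup D))) (λ D bad → <⇒≤ (≰⇒> bad))) ⟩
    Q * (n * length (goodSeeds r G) + 2 * r * length (subsets n r))
      ≤⟨ *-monoʳ-≤ Q (+-monoʳ-≤ (n * length (goodSeeds r G))
                        (*-monoʳ-≤ (2 * r) (≤-trans (≤-reflexive (length-subsets n r)) (choose≤^ n r)))) ⟩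
    Q * (n * length (goodSeeds r G) + 2 * r * n ^ r)
      ∎) N≤n
    where
      open ≤-Reasoning
      r = suc s
      Q = (2 * r) ^ r
      n≢0 : NonZero n
      n≢0 = >-nonZero (≤-trans (*-mono-≤ {1} {2 * (2 * r)} (s≤s z≤n) (m^n>0 (2 * r) r)) N≤n)

theorem5 : (r : ℕ) → 1 ≤ r →
    Σ ℕ λ p → Σ ℕ λ q → 1 ≤ p × 1 ≤ q × ∃ λ N →
    (n : ℕ) → N ≤ n → (G : Graph n) → Connected G →
    (∀ v → n + 2 * r ≤ 2 * degree G v) →
    Σ (List (Subset n)) λ Ds →
    Unique Ds × All (λ D → ∣ D ∣ ≡ r × Dynamo r G D) Ds ×
    p * n ^ r ≤ q * length Ds
theorem5 zero    ()
theorem5 (suc s) _ =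
  1 , 2 * Q , ≤-refl , ≤-trans (m^n>0 (2 * suc s) (suc s)) (m≤m+n Q (Q + 0)) , 2 * (2 * suc s) * Q ,
  λ n N≤n G _ min-degree →
    goodSeeds (suc s) G ,
    Uniqueₚ.filter⁺ (good? (suc s) G) (subsets-unique n (suc s)) ,
    goodSeeds-dynamos s G min-degree ,
    ≤-trans (≤-reflexive (*-identityˡ (n ^ suc s))) (many-goodSeeds s G min-degree N≤n)
  where
    Q = (2 * suc s) ^ suc s
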